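{- Let $a<b$ be relatively prime positive integers and $\mathcal{U}=\mathcal{U}(a,b)$. If $i,j$ are integers with $0<i<a$ and $0<j<b$, then $ja+ib\in\mathcal{U}$ if and only if $j=1$, or $i=1$, or both $i$ and $j$ are odd.
   Context: For positive integers $a<b$, the Ulam sequence $\mathcal{U}(a,b)$ has first terms $a,b$, and each subsequent term is the smallest integer larger than all previous terms that can be written as the sum of two distinct earlier terms in exactly one way (unordered pairs). The sequence is identified with its set of terms. -}

module Defs where

open import Data.Nat using (ℕ; zero; suc; _+_; _≡ᵇ_; _<ᵇ_)
open import Data.Nat.Divisibility using (_∣_)
open import Data.Bool using (Bool; true; false; _∧_; _∨_; if_then_else_; T)
open import Data.List using (List; []; _∷_; _++_; length; filter; concatMap)
open import Relation.Nullary using (¬_)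
open import Relation.Nullary.Decidable using (does)
open import Data.Nat.Properties using (_≟_)

-- Number of unordered pairs {x , y} with x ≠ y (we take x < y), x , y ∈ L, x + y = n.
-- L is assumed to be a list without duplicates.
countReps : ℕ → List ℕ → ℕ
countReps n L =
  length (concatMap (λ x → concatMap (λ y →
    if (x <ᵇ y) ∧ ((x + y) ≡ᵇ n) then (x ∷ []) else []) L) L)

-- Given the list L of all Ulam terms smaller than n, decide whether n is a term:
-- n is a term iff n = a, or n = b, or n > b and n is a sum of two distinct
-- earlier terms in exactly one way.  (Since every term after b exceeds b and
-- terms are produced in increasing order, "smallest integer larger than all
-- previous terms with a unique representation" is exactly this.)
isTermGiven : ℕ → ℕ → ℕ → List ℕ → Bool
isTermGiven a b n L =
  (n ≡ᵇ a) ∨ (n ≡ᵇ b) ∨ ((b <ᵇ n) ∧ (countReps n L ≡ᵇ 1))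

ulamBelow : ℕ → ℕ → ℕ → List ℕ
ulamBelow a b zero = []
ulamBelow a b (suc n) = extend (ulamBelow a b n)
  where
  extend : List ℕ → List ℕ
  extend L = L ++ (if isTermGiven a b n L then n ∷ [] else [])

isUlam : ℕ → ℕ → ℕ → Bool
isUlam a b n = isTermGiven a b n (ulamBelow a b n)

_∈U[_,_] : ℕ → ℕ → ℕ → Set
n ∈U[ a , b ] = T (isUlam a b n)

Odd : ℕ → Set
Odd n = ¬ (2 ∣ n)

{-# OPTIONS --safe #-}
-- Write val (i , j) = j a + i b.  Every Ulam term is a nonnegative combination of
-- a and b, and by coprimality val is injective on points with i < a, so every term
-- is val P for a unique such P.  For P in the box i < a, j < b, two terms adding up
-- to val P come from a splitting P = Q ⊕ R of lattice points: a carry in the first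
-- coordinate would push the coefficient of a to at least b.  Hence, by induction on
-- i + j, val P is a term exactly when P has exactly one splitting into two distinct
-- special points, where (i , j) is special if j = 1, i = 1, or i and j are both odd.
-- Counting these splittings is elementary: a special point off the axes splits in
-- exactly one way (two odd-odd summands have an even sum, so some summand has a
-- coordinate 1, which pins the split down), a non-special one in at least two ways,
-- and a point on an axis has no splitting into distinct special points.

module Submission where

open import Defs
open import Data.Nat
  using (ℕ; zero; suc; _+_; _*_; _%_; _/_; _<_; _≤_; z≤n; z<s; _<?_; _<ᵇ_; _≡ᵇ_; NonZero; >-nonZero)
open import Data.Nat.Properties
open import Data.Nat.DivMod using (m%n<n; m≡m%n+[m/n]*n)
open import Data.Nat.Induction using (<-rec; <-wellFounded)
open import Induction.WellFounded using (module All)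
import Relation.Binary.Construct.On as On
open import Level using (0ℓ)
open import Data.Nat.Coprimality using (Coprime; coprime-divisor)
open import Data.Nat.Divisibility
  using (_∣_; _∣?_; ∣-refl; _∣0; ∣1⇒≡1; ∣m∣n⇒∣m+n; ∣m+n∣m⇒∣n; n∣m*n; >⇒∤)
open import Data.Product using (_×_; _,_; Σ; proj₁; proj₂)
open import Data.Product.Properties using (,-injectiveˡ; ,-injectiveʳ)
open import Data.Sum using (_⊎_; inj₁; inj₂; [_,_]′)
open import Data.Empty using (⊥; ⊥-elim)
open import Function.Base using (id; _∘_; _∋_; case_of_)
open import Function.Bundles using (Equivalence; _⇔_; mk⇔)
open import Data.Bool using (true; false; T; _∧_; if_then_else_)
open import Data.Bool.Properties using (T-∧; T-∨; T-≡)
open import Data.Unit using (tt)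
open import Data.List using (List; []; _∷_; _++_; length; map; concatMap)
open import Data.List.Properties using (length-++; map-++)
open import Data.Nat.ListAction using (sum)
open import Data.Nat.ListAction.Properties using (sum-++)
open import Data.Nat.Tactic.RingSolver using (solve)
open import Relation.Nullary using (¬_; Dec; yes; no; ¬?)
open import Relation.Nullary.Decidable using (_×-dec_; _⊎-dec_)
open import Relation.Binary.Definitions using (tri<; tri≈; tri>)
open import Relation.Binary.PropositionalEquality
  using (_≡_; _≢_; refl; sym; trans; cong; cong₂; subst; module ≡-Reasoning)

even⊎even-suc : ∀ n → 2 ∣ n ⊎ 2 ∣ suc n
even⊎even-suc zero = inj₁ (2 ∣0)
even⊎even-suc (suc n) = [ inj₂ ∘ ∣m∣n⇒∣m+n ∣-refl , inj₁ ]′ (even⊎even-suc n)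

even⇒odd-suc : ∀ {n} → 2 ∣ n → Odd (suc n)
even⇒odd-suc {n} 2∣n 2∣1+n =
  1+n≢0 {0} (suc-injective (∣1⇒≡1 (∣m+n∣m⇒∣n (subst (2 ∣_) (+-comm 1 n) 2∣1+n) 2∣n)))

even-suc⇒odd : ∀ {n} → 2 ∣ suc n → Odd n
even-suc⇒odd 2∣1+n 2∣n = even⇒odd-suc 2∣n 2∣1+n

odd-suc⇒even : ∀ {n} → Odd (suc n) → 2 ∣ n
odd-suc⇒even {n} odd = [ id , ⊥-elim ∘ odd ]′ (even⊎even-suc n)

odd+odd⇒even : ∀ {m n} → Odd m → Odd n → 2 ∣ m + n
odd+odd⇒even {zero} odd _ = ⊥-elim (odd (2 ∣0))
odd+odd⇒even {suc m} {zero} _ odd = ⊥-elim (odd (2 ∣0))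
odd+odd⇒even {suc m} {suc n} oddm oddn = subst (2 ∣_) (cong suc (sym (+-suc m n)))
  (∣m∣n⇒∣m+n ∣-refl (∣m∣n⇒∣m+n (odd-suc⇒even oddm) (odd-suc⇒even oddn)))

-- Lattice points and their special splittings

Point : Set
Point = ℕ × ℕ

infixl 6 _⊕_

_⊕_ : Point → Point → Point
(p , q) ⊕ (p' , q') = p + p' , q + q'

⊕-comm : ∀ P Q → P ⊕ Q ≡ Q ⊕ P
⊕-comm (p , q) (p' , q') = cong₂ _,_ (+-comm p p') (+-comm q q')

⊕-cancelˡ : ∀ P {Q R} → P ⊕ Q ≡ P ⊕ R → Q ≡ R
⊕-cancelˡ (p , q) eq =
  cong₂ _,_ (+-cancelˡ-≡ p _ _ (,-injectiveˡ eq)) (+-cancelˡ-≡ q _ _ (,-injectiveʳ eq))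

⊕-complement : ∀ {Q R Q' R'} → Q ⊕ R ≡ Q' ⊕ R' → Q' ≡ R → R' ≡ Q
⊕-complement {Q} {R} eq refl = ⊕-cancelˡ R (trans (sym eq) (⊕-comm Q R))

size : Point → ℕ
size (p , q) = p + q

0<size : ∀ {P} → P ≢ (0 , 0) → 0 < size P
0<size {zero , zero} P≢0 = ⊥-elim (P≢0 refl)
0<size {zero , suc q} _ = z<s
0<size {suc p , q} _ = z<s

size-⊕ : ∀ Q R → size (Q ⊕ R) ≡ size Q + size R
size-⊕ (p , q) (p' , q') =
  (p + p') + (q + q') ≡ (p + q) + (p' + q') ∋ solve (p ∷ q ∷ p' ∷ q' ∷ [])

summand-size-< : ∀ {P Q R} → Q ⊕ R ≡ P → R ≢ (0 , 0) → size Q < size P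
summand-size-< {Q = Q} {R} refl R≢0 = subst (size Q <_) (sym (size-⊕ Q R)) (m<m+n (size Q) (0<size R≢0))

Special : Point → Set
Special (i , j) = j ≡ 1 ⊎ i ≡ 1 ⊎ (Odd i × Odd j)

special? : ∀ P → Dec (Special P)
special? (i , j) = j ≟ 1 ⊎-dec i ≟ 1 ⊎-dec ¬? (2 ∣? i) ×-dec ¬? (2 ∣? j)

special-0, : ∀ {j} → Special (0 , j) → j ≡ 1
special-0, (inj₁ j≡1) = j≡1
special-0, (inj₂ (inj₂ (odd , _))) = ⊥-elim (odd (2 ∣0))

special-,0 : ∀ {i} → Special (i , 0) → i ≡ 1
special-,0 (inj₂ (inj₁ i≡1)) = i≡1
special-,0 (inj₂ (inj₂ (_ , odd))) = ⊥-elim (odd (2 ∣0))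

special⇒≢0 : ∀ {P} → Special P → P ≢ (0 , 0)
special⇒≢0 special refl with special-0, special
... | ()

SpecialSplit : Point → Point → Point → Set
SpecialSplit P Q R = Q ⊕ R ≡ P × Special Q × Special R

split-comm : ∀ {P Q R} → SpecialSplit P Q R → SpecialSplit P R Q
split-comm {Q = Q} {R} (eq , sQ , sR) = trans (⊕-comm R Q) eq , sR , sQ

split-complement : ∀ {P Q R Q' R'} → SpecialSplit P Q R → SpecialSplit P Q' R' → Q' ≡ R → R' ≡ Q
split-complement (eq , _) (eq' , _) = ⊕-complement (trans eq (sym eq'))

split-0, : ∀ {j Q R} → SpecialSplit (0 , j) Q R → Q ≡ R
split-0, {Q = p , q} {p' , q'} (eq , sQ , sR)
  with m+n≡0⇒m≡0 p (,-injectiveˡ eq) | m+n≡0⇒n≡0 p (,-injectiveˡ eq)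
... | refl | refl = cong (0 ,_) (trans (special-0, sQ) (sym (special-0, sR)))

split-,0 : ∀ {i Q R} → SpecialSplit (i , 0) Q R → Q ≡ R
split-,0 {Q = p , q} {p' , q'} (eq , sQ , sR)
  with m+n≡0⇒m≡0 q (,-injectiveʳ eq) | m+n≡0⇒n≡0 q (,-injectiveʳ eq)
... | refl | refl = cong (_, 0) (trans (special-,0 sQ) (sym (special-,0 sR)))

_∈⟨_,_⟩ : Point → Point → Point → Set
A ∈⟨ Q , R ⟩ = A ≡ Q ⊎ A ≡ R

record UniqueSplit (P : Point) : Set where
  constructor uniqueSplit
  field
    {Q R} : Point
    split : SpecialSplit P Q R
    distinct : Q ≢ R
    unique : ∀ {Q' R'} → SpecialSplit P Q' R' → Q' ∈⟨ Q , R ⟩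

record TwoSplits (P : Point) : Set where
  constructor twoSplits
  field
    {Q R Q' R'} : Point
    split : SpecialSplit P Q R
    split' : SpecialSplit P Q' R'
    distinct : Q ≢ R
    distinct' : Q' ≢ R'
    Q'≢Q : Q' ≢ Q
    Q'≢R : Q' ≢ R

uniqueSplit-swap : ∀ {P} → UniqueSplit P → UniqueSplit P
uniqueSplit-swap (uniqueSplit s d u) =
  uniqueSplit (split-comm s) (d ∘ sym) ([ inj₂ , inj₁ ]′ ∘ u)

two-splits-disjoint : ∀ {P} (t : TwoSplits P) {A} → let open TwoSplits t in
                      A ∈⟨ Q , R ⟩ → A ∈⟨ Q' , R' ⟩ → ⊥
two-splits-disjoint (twoSplits s s' _ _ Q'≢Q Q'≢R) (inj₁ refl) (inj₁ A≡Q') = Q'≢Q (sym A≡Q')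
two-splits-disjoint (twoSplits s s' _ _ Q'≢Q Q'≢R) (inj₂ refl) (inj₁ A≡Q') = Q'≢R (sym A≡Q')
two-splits-disjoint (twoSplits s s' _ _ Q'≢Q Q'≢R) (inj₁ refl) (inj₂ A≡R') =
  Q'≢R (split-complement (split-comm s) (split-comm s') (sym A≡R'))
two-splits-disjoint (twoSplits s s' _ _ Q'≢Q Q'≢R) (inj₂ refl) (inj₂ A≡R') =
  Q'≢Q (split-complement s (split-comm s') (sym A≡R'))

corner-split : ∀ i j → SpecialSplit (suc i , suc j) (1 , j) (i , 1)
corner-split i j = cong (suc i ,_) (+-comm j 1) , inj₂ (inj₁ refl) , inj₁ refl

m+1≡1+n⇒m≡n : ∀ {m n} → m + 1 ≡ suc n → m ≡ n
m+1≡1+n⇒m≡n {m} eq = suc-injective (trans (+-comm 1 m) eq)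

special-split-unique : ∀ i j → Special (suc i , suc j) → UniqueSplit (suc i , suc j)
special-split-unique i zero _ = uniqueSplit (corner-split i 0) (λ ()) unique
  where
  unique : ∀ {Q' R'} → SpecialSplit (suc i , 1) Q' R' → Q' ∈⟨ (1 , 0) , (i , 1) ⟩
  unique {p , zero} (_ , sQ , _) = inj₁ (cong (_, 0) (special-,0 sQ))
  unique {p , suc zero} {p' , zero} (eq , _ , sR) with special-,0 sR
  ... | refl = inj₂ (cong (_, 1) (m+1≡1+n⇒m≡n (,-injectiveˡ eq)))
  unique {p , suc zero} {p' , suc q'} (eq , _) with ,-injectiveʳ eq
  ... | ()
  unique {p , suc (suc q)} (eq , _) with ,-injectiveʳ eq
  ... | ()
special-split-unique zero (suc j) _ =
  uniqueSplit (split-comm (corner-split 0 (suc j))) (λ ()) unique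
  where
  unique : ∀ {Q' R'} → SpecialSplit (1 , suc (suc j)) Q' R' → Q' ∈⟨ (0 , 1) , (1 , suc j) ⟩
  unique {zero , q} (_ , sQ , _) = inj₁ (cong (0 ,_) (special-0, sQ))
  unique {suc zero , q} {zero , q'} (eq , _ , sR) with special-0, sR
  ... | refl = inj₂ (cong (1 ,_) (m+1≡1+n⇒m≡n (,-injectiveʳ eq)))
  unique {suc zero , q} {suc p' , q'} (eq , _) with ,-injectiveˡ eq
  ... | ()
  unique {suc (suc p) , q} (eq , _) with ,-injectiveˡ eq
  ... | ()
special-split-unique (suc i) (suc j) (inj₁ ())
special-split-unique (suc i) (suc j) (inj₂ (inj₁ ()))
special-split-unique (suc i) (suc j) (inj₂ (inj₂ (oddi , oddj))) =
  uniqueSplit (corner-split (suc i) (suc j)) distinct unique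
  where
  P = suc (suc i) , suc (suc j)
  2∣i : 2 ∣ suc i
  2∣i = odd-suc⇒even oddi
  2∣j : 2 ∣ suc j
  2∣j = odd-suc⇒even oddj
  distinct : (1 , suc j) ≢ (suc i , 1)
  distinct refl = oddi ∣-refl
  unique : ∀ {Q' R'} → SpecialSplit P Q' R' → Q' ∈⟨ (1 , suc j) , (suc i , 1) ⟩
  unique {p , q} {p' , q'} (eq , inj₁ refl , sR) with suc-injective (,-injectiveʳ eq)
  ... | refl with sR
  ...   | inj₁ refl = ⊥-elim (even⇒odd-suc (2 ∣0) 2∣j)
  ...   | inj₂ (inj₁ refl) = inj₂ (cong (_, 1) (m+1≡1+n⇒m≡n (,-injectiveˡ eq)))
  ...   | inj₂ (inj₂ (_ , oddq')) = ⊥-elim (oddq' 2∣j)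
  unique {p , q} {p' , q'} (eq , inj₂ (inj₁ refl) , sR) with suc-injective (,-injectiveˡ eq)
  ... | refl with sR
  ...   | inj₁ refl = inj₁ (cong (1 ,_) (m+1≡1+n⇒m≡n (,-injectiveʳ eq)))
  ...   | inj₂ (inj₁ refl) = ⊥-elim (even⇒odd-suc (2 ∣0) 2∣i)
  ...   | inj₂ (inj₂ (oddp' , _)) = ⊥-elim (oddp' 2∣i)
  unique {p , q} {p' , q'} (eq , inj₂ (inj₂ (oddp , oddq)) , inj₁ refl) =
    ⊥-elim (oddq (subst (2 ∣_) (sym (m+1≡1+n⇒m≡n (,-injectiveʳ eq))) 2∣j))
  unique {p , q} {p' , q'} (eq , inj₂ (inj₂ (oddp , oddq)) , inj₂ (inj₁ refl)) =
    ⊥-elim (oddp (subst (2 ∣_) (sym (m+1≡1+n⇒m≡n (,-injectiveˡ eq))) 2∣i))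
  unique {p , q} {p' , q'} (eq , inj₂ (inj₂ (oddp , oddq)) , inj₂ (inj₂ (oddp' , _))) =
    ⊥-elim (oddi (subst (2 ∣_) (,-injectiveˡ eq) (odd+odd⇒even oddp oddp')))

nonspecial-two-splits : ∀ i j → ¬ Special (suc i , suc j) → TwoSplits (suc i , suc j)
nonspecial-two-splits zero j nonspecial = ⊥-elim (nonspecial (inj₂ (inj₁ refl)))
nonspecial-two-splits (suc i) zero nonspecial = ⊥-elim (nonspecial (inj₁ refl))
nonspecial-two-splits (suc i) (suc j) nonspecial with 2 ∣? suc (suc i) | 2 ∣? suc (suc j)
... | no oddi | no oddj = ⊥-elim (nonspecial (inj₂ (inj₂ (oddi , oddj))))
nonspecial-two-splits (suc zero) (suc j) _ | no oddi | yes _ = ⊥-elim (oddi ∣-refl)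
nonspecial-two-splits (suc (suc i)) (suc j) _ | no oddi | yes 2∣j =
  twoSplits {Q' = 0 , 1} {R' = suc (suc (suc i)) , suc j} (corner-split (suc (suc i)) (suc j))
    (refl , inj₁ refl , inj₂ (inj₂ (oddi , even-suc⇒odd 2∣j)))
    (λ ()) (λ ()) (λ ()) (λ ())
nonspecial-two-splits (suc i) (suc zero) _ | yes _ | no oddj = ⊥-elim (oddj ∣-refl)
nonspecial-two-splits (suc i) (suc (suc j)) _ | yes 2∣i | no oddj =
  twoSplits {Q' = 1 , 0} {R' = suc i , suc (suc (suc j))} (corner-split (suc i) (suc (suc j)))
    (refl , inj₂ (inj₁ refl) , inj₂ (inj₂ (even-suc⇒odd 2∣i , oddj)))
    (λ ()) (λ ()) (λ ()) (λ ())
nonspecial-two-splits (suc zero) (suc zero) _ | yes _ | yes _ =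
  twoSplits {Q = 0 , 1} {2 , 1} {1 , 0} {1 , 2}
    (refl , inj₁ refl , inj₁ refl) (refl , inj₂ (inj₁ refl) , inj₂ (inj₁ refl))
    (λ ()) (λ ()) (λ ()) (λ ())
nonspecial-two-splits (suc zero) (suc (suc j)) _ | yes _ | yes _ =
  twoSplits {Q = 1 , 0} {1 , suc (suc (suc j))} {1 , 1} {1 , suc (suc j)}
    (refl , inj₂ (inj₁ refl) , inj₂ (inj₁ refl)) (refl , inj₁ refl , inj₂ (inj₁ refl))
    (λ ()) (λ ()) (λ ()) (λ ())
nonspecial-two-splits (suc (suc i)) (suc zero) _ | yes _ | yes _ =
  twoSplits {Q = 0 , 1} {suc (suc (suc i)) , 1} {1 , 1} {suc (suc i) , 1}
    (refl , inj₁ refl , inj₁ refl) (refl , inj₁ refl , inj₁ refl)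
    (λ ()) (λ ()) (λ ()) (λ ())
nonspecial-two-splits (suc (suc i)) (suc (suc j)) _ | yes 2∣i | yes 2∣j =
  twoSplits {Q' = 1 , 1} {R' = suc (suc i) , suc (suc j)} (corner-split (suc (suc i)) (suc (suc j)))
    (refl , inj₁ refl , inj₂ (inj₂ (even-suc⇒odd 2∣i , even-suc⇒odd 2∣j)))
    (λ ()) (λ ()) (λ ()) (λ ())

sumTo : ℕ → (ℕ → ℕ) → ℕ
sumTo zero h = 0
sumTo (suc k) h = sumTo k h + h k

sumTo-cong : ∀ k {g h : ℕ → ℕ} → (∀ m → g m ≡ h m) → sumTo k g ≡ sumTo k h
sumTo-cong zero eq = refl
sumTo-cong (suc k) eq = cong₂ _+_ (sumTo-cong k eq) (eq k)

sumTo-≢0 : ∀ k h → sumTo k h ≢ 0 → Σ ℕ λ m → m < k × h m ≢ 0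
sumTo-≢0 zero h ne = ⊥-elim (ne refl)
sumTo-≢0 (suc k) h ne with h k ≟ 0
... | no hk≢0 = k , n<1+n k , hk≢0
... | yes hk≡0 with sumTo-≢0 k h (λ s≡0 → ne (cong₂ _+_ s≡0 hk≡0))
...   | m , m<k , hm≢0 = m , m<n⇒m<1+n m<k , hm≢0

sumTo-≡0 : ∀ k h → (∀ m → m < k → h m ≡ 0) → sumTo k h ≡ 0
sumTo-≡0 zero h _ = refl
sumTo-≡0 (suc k) h vanish = cong₂ _+_ (sumTo-≡0 k h (λ m → vanish m ∘ m<n⇒m<1+n)) (vanish k (n<1+n k))

sumTo-≡1 : ∀ k h {m₀} → m₀ < k → h m₀ ≡ 1 → (∀ m → m < k → h m ≢ 0 → m ≡ m₀) → sumTo k h ≡ 1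
sumTo-≡1 (suc k) h m₀<1+k hm₀≡1 only with m<1+n⇒m<n∨m≡n m₀<1+k
... | inj₂ refl = cong₂ _+_ (sumTo-≡0 k h outside) hm₀≡1
  where
  outside : ∀ m → m < k → h m ≡ 0
  outside m m<k with h m ≟ 0
  ... | yes hm≡0 = hm≡0
  ... | no hm≢0 = ⊥-elim (<⇒≢ m<k (only m (m<n⇒m<1+n m<k) hm≢0))
... | inj₁ m₀<k = cong₂ _+_ (sumTo-≡1 k h m₀<k hm₀≡1 (λ m → only m ∘ m<n⇒m<1+n)) hk≡0
  where
  hk≡0 : h k ≡ 0
  hk≡0 with h k ≟ 0
  ... | yes hk≡0 = hk≡0
  ... | no hk≢0 = ⊥-elim (<⇒≢ m₀<k (sym (only k (n<1+n k) hk≢0)))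

h≤sumTo : ∀ k h {m} → m < k → h m ≤ sumTo k h
h≤sumTo (suc k) h m<1+k with m<1+n⇒m<n∨m≡n m<1+k
... | inj₂ refl = m≤n+m _ _
... | inj₁ m<k = ≤-trans (h≤sumTo k h m<k) (m≤m+n _ _)

2≤sumTo : ∀ k h {m m'} → m < k → m' < k → m ≢ m' → h m ≢ 0 → h m' ≢ 0 → 2 ≤ sumTo k h
2≤sumTo (suc k) h m<1+k m'<1+k m≢m' hm≢0 hm'≢0
  with m<1+n⇒m<n∨m≡n m<1+k | m<1+n⇒m<n∨m≡n m'<1+k
... | inj₂ refl | inj₂ refl = ⊥-elim (m≢m' refl)
... | inj₂ refl | inj₁ m'<k = +-mono-≤ (≤-trans (n≢0⇒n>0 hm'≢0) (h≤sumTo k h m'<k)) (n≢0⇒n>0 hm≢0)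
... | inj₁ m<k | inj₂ refl = +-mono-≤ (≤-trans (n≢0⇒n>0 hm≢0) (h≤sumTo k h m<k)) (n≢0⇒n>0 hm'≢0)
... | inj₁ m<k | inj₁ m'<k = ≤-trans (2≤sumTo k h m<k m'<k m≢m' hm≢0 hm'≢0) (m≤m+n _ _)

-- The Ulam recurrence

length-concatMap : ∀ (f : ℕ → List ℕ) xs → length (concatMap f xs) ≡ sum (map (length ∘ f) xs)
length-concatMap f [] = refl
length-concatMap f (x ∷ xs) = trans (length-++ (f x)) (cong (length (f x) +_) (length-concatMap f xs))

pairCount : ℕ → ℕ → ℕ → ℕ
pairCount n x y = length (if (x <ᵇ y) ∧ (x + y ≡ᵇ n) then x ∷ [] else [])

pairCount-≢0 : ∀ n x y → pairCount n x y ≢ 0 → x < y × x + y ≡ n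
pairCount-≢0 n x y ne with (x <ᵇ y) ∧ (x + y ≡ᵇ n) in eq
... | false = ⊥-elim (ne refl)
... | true = let x<ᵇy , x+y≡ᵇn = Equivalence.to T-∧ (subst T (sym eq) tt)
             in <ᵇ⇒< x y x<ᵇy , ≡ᵇ⇒≡ (x + y) n x+y≡ᵇn

pairCount-≡1 : ∀ {n x y} → x < y → x + y ≡ n → pairCount n x y ≡ 1
pairCount-≡1 {n} {x} {y} x<y x+y≡n
  rewrite Equivalence.to T-≡ (Equivalence.from T-∧ (<⇒<ᵇ x<y , ≡⇒≡ᵇ (x + y) n x+y≡n)) = refl

0∉U : ∀ {a b} → 0 < a → 0 < b → ¬ 0 ∈U[ a , b ]
0∉U {suc a} {suc b} _ _ ()

module Recurrence (a b : ℕ) (0<a : 0 < a) (0<b : 0 < b) where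
  open ≡-Reasoning

  IsRep : ℕ → ℕ → Set
  IsRep n x = x ∈U[ a , b ] × Σ ℕ λ y → y ∈U[ a , b ] × x < y × x + y ≡ n

  onU : (ℕ → ℕ) → ℕ → ℕ
  onU F x = if isUlam a b x then F x else 0

  onU-≢0 : ∀ F x → onU F x ≢ 0 → x ∈U[ a , b ] × F x ≢ 0
  onU-≢0 F x ne with isUlam a b x
  ... | true = tt , ne
  ... | false = ⊥-elim (ne refl)

  onU-∈U : ∀ F x → x ∈U[ a , b ] → onU F x ≡ F x
  onU-∈U F x x∈U with isUlam a b x
  ... | true = refl

  sum-map-ulamBelow : ∀ F k → sum (map F (ulamBelow a b k)) ≡ sumTo k (onU F)
  sum-map-ulamBelow F zero = refl
  sum-map-ulamBelow F (suc k) = begin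
    sum (map F (ulamBelow a b k ++ new))          ≡⟨ cong sum (map-++ F (ulamBelow a b k) new) ⟩
    sum (map F (ulamBelow a b k) ++ map F new)    ≡⟨ sum-++ (map F (ulamBelow a b k)) (map F new) ⟩
    sum (map F (ulamBelow a b k)) + sum (map F new) ≡⟨ cong₂ _+_ (sum-map-ulamBelow F k) last ⟩
    sumTo k (onU F) + onU F k                     ∎
    where
    new = if isUlam a b k then k ∷ [] else []
    last : sum (map F new) ≡ onU F k
    last with isUlam a b k
    ... | true = +-identityʳ (F k)
    ... | false = refl

  partnersBelow : ℕ → ℕ → ℕ
  partnersBelow n x = sumTo n (onU (pairCount n x))

  repIndicator : ℕ → ℕ → ℕ
  repIndicator n = onU (partnersBelow n)

  repCount : ℕ → ℕ
  repCount n = countReps n (ulamBelow a b n)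

  repCount-sumTo : ∀ n → repCount n ≡ sumTo n (repIndicator n)
  repCount-sumTo n = begin
    repCount n ≡⟨ length-concatMap _ (ulamBelow a b n) ⟩
    sum (map _ (ulamBelow a b n)) ≡⟨ sum-map-ulamBelow _ n ⟩
    sumTo n (onU _) ≡⟨ sumTo-cong n (λ x → cong (λ c → if isUlam a b x then c else 0) (partners x)) ⟩
    sumTo n (repIndicator n) ∎
    where
    partners : ∀ x → length (concatMap _ (ulamBelow a b n)) ≡ partnersBelow n x
    partners x = trans (length-concatMap _ (ulamBelow a b n)) (sum-map-ulamBelow (pairCount n x) n)

  summands-< : ∀ {n x y} → x ∈U[ a , b ] → x < y → x + y ≡ n → x < n × y < n
  summands-< {x = x} {y} x∈U x<y refl =
    m<m+n x (≤-<-trans z≤n x<y) , m<n+m y (n≢0⇒n>0 λ { refl → 0∉U 0<a 0<b x∈U })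

  repIndicator-≢0 : ∀ {n x} → repIndicator n x ≢ 0 → IsRep n x
  repIndicator-≢0 {n} {x} ne with onU-≢0 (partnersBelow n) x ne
  ... | x∈U , inner≢0 with sumTo-≢0 n _ inner≢0
  ...   | y , _ , pair≢0 with onU-≢0 (pairCount n x) y pair≢0
  ...     | y∈U , count≢0 = x∈U , y , y∈U , pairCount-≢0 n x y count≢0

  repIndicator-rep : ∀ {n x} → IsRep n x → repIndicator n x ≡ 1
  repIndicator-rep {n} {x} (x∈U , y , y∈U , x<y , x+y≡n) =
    trans (onU-∈U (partnersBelow n) x x∈U) (sumTo-≡1 n _ (proj₂ (summands-< x∈U x<y x+y≡n))
      (trans (onU-∈U (pairCount n x) y y∈U) (pairCount-≡1 x<y x+y≡n)) only)
    where
    only : ∀ m → m < n → onU (pairCount n x) m ≢ 0 → m ≡ y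
    only m _ ne =
      +-cancelˡ-≡ x m y (trans (proj₂ (pairCount-≢0 n x m (proj₂ (onU-≢0 (pairCount n x) m ne)))) (sym x+y≡n))

  IsRep-< : ∀ {n x} → IsRep n x → x < n
  IsRep-< (x∈U , _ , _ , x<y , x+y≡n) = proj₁ (summands-< x∈U x<y x+y≡n)

  ∈U-unfold : ∀ {n} → n ∈U[ a , b ] → n ≡ a ⊎ n ≡ b ⊎ (b < n × repCount n ≡ 1)
  ∈U-unfold {n} n∈U with Equivalence.to T-∨ n∈U
  ... | inj₁ n≡ᵇa = inj₁ (≡ᵇ⇒≡ n a n≡ᵇa)
  ... | inj₂ n∈U' with Equivalence.to T-∨ n∈U'
  ...   | inj₁ n≡ᵇb = inj₂ (inj₁ (≡ᵇ⇒≡ n b n≡ᵇb))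
  ...   | inj₂ n∈U'' with Equivalence.to T-∧ n∈U''
  ...     | b<ᵇn , count≡ᵇ1 = inj₂ (inj₂ (<ᵇ⇒< b n b<ᵇn , ≡ᵇ⇒≡ (repCount n) 1 count≡ᵇ1))

  ∈U-fold : ∀ {n} → b < n → repCount n ≡ 1 → n ∈U[ a , b ]
  ∈U-fold {n} b<n count≡1 = Equivalence.from (T-∨ {n ≡ᵇ a}) (inj₂ (Equivalence.from (T-∨ {n ≡ᵇ b})
    (inj₂ (Equivalence.from T-∧ (<⇒<ᵇ b<n , ≡⇒≡ᵇ (repCount n) 1 count≡1)))))

  a∈U : a ∈U[ a , b ]
  a∈U = Equivalence.from T-∨ (inj₁ (≡⇒≡ᵇ a a refl))

  b∈U : b ∈U[ a , b ]
  b∈U = Equivalence.from (T-∨ {b ≡ᵇ a}) (inj₂ (Equivalence.from T-∨ (inj₁ (≡⇒≡ᵇ b b refl))))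

  repCount-≢0 : ∀ {n} → repCount n ≢ 0 → Σ ℕ (IsRep n)
  repCount-≢0 {n} count≢0 with sumTo-≢0 n _ (count≢0 ∘ trans (repCount-sumTo n))
  ... | x , _ , ind≢0 = x , repIndicator-≢0 ind≢0

  ∈U-cases : ∀ {n} → n ∈U[ a , b ] → n ≡ a ⊎ n ≡ b ⊎ Σ ℕ (IsRep n)
  ∈U-cases n∈U with ∈U-unfold n∈U
  ... | inj₁ n≡a = inj₁ n≡a
  ... | inj₂ (inj₁ n≡b) = inj₂ (inj₁ n≡b)
  ... | inj₂ (inj₂ (_ , count≡1)) =
    inj₂ (inj₂ (repCount-≢0 (λ count≡0 → 1+n≢0 (trans (sym count≡1) count≡0))))

  unique-rep⇒∈U : ∀ {n x} → b < n → IsRep n x → (∀ {x'} → IsRep n x' → x' ≡ x) → n ∈U[ a , b ]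
  unique-rep⇒∈U {n} b<n rep only = ∈U-fold b<n (trans (repCount-sumTo n)
    (sumTo-≡1 n _ (IsRep-< rep) (repIndicator-rep rep) (λ _ _ → only ∘ repIndicator-≢0)))

  repCount≢1⇒∉U : ∀ {n} → n ≢ a → n ≢ b → repCount n ≢ 1 → ¬ n ∈U[ a , b ]
  repCount≢1⇒∉U n≢a n≢b count≢1 n∈U with ∈U-unfold n∈U
  ... | inj₁ n≡a = n≢a n≡a
  ... | inj₂ (inj₁ n≡b) = n≢b n≡b
  ... | inj₂ (inj₂ (_ , count≡1)) = count≢1 count≡1

  no-rep⇒∉U : ∀ {n} → n ≢ a → n ≢ b → (∀ {x} → ¬ IsRep n x) → ¬ n ∈U[ a , b ]
  no-rep⇒∉U n≢a n≢b norep = repCount≢1⇒∉U n≢a n≢b λ count≡1 →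
    norep (proj₂ (repCount-≢0 (λ count≡0 → 1+n≢0 (trans (sym count≡1) count≡0))))

  two-reps⇒∉U : ∀ {n x x'} → n ≢ a → n ≢ b → IsRep n x → IsRep n x' → x ≢ x' → ¬ n ∈U[ a , b ]
  two-reps⇒∉U {n} n≢a n≢b rep rep' x≢x' = repCount≢1⇒∉U n≢a n≢b λ count≡1 →
    <-irrefl refl (subst (2 ≤_) (trans (sym (repCount-sumTo n)) count≡1)
      (2≤sumTo n _ (IsRep-< rep) (IsRep-< rep') x≢x' (nonzero rep) (nonzero rep')))
    where
    nonzero : ∀ {x} → IsRep n x → repIndicator n x ≢ 0
    nonzero rep ind≡0 = 1+n≢0 (trans (sym (repIndicator-rep rep)) ind≡0)

-- The map (i , j) ↦ j a + i b

module Lattice (a b : ℕ) (0<a : 0 < a) (0<b : 0 < b) (coprime : Coprime a b) where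
  open Recurrence a b 0<a 0<b

  instance
    a-nonZero : NonZero a
    a-nonZero = >-nonZero 0<a

  val : Point → ℕ
  val (i , j) = j * a + i * b

  val-0,1 : val (0 , 1) ≡ a
  val-0,1 = trans (+-identityʳ _) (+-identityʳ a)

  val-1,0 : val (1 , 0) ≡ b
  val-1,0 = +-identityʳ b

  val-⊕ : ∀ P Q → val (P ⊕ Q) ≡ val P + val Q
  val-⊕ (p , q) (p' , q') = (q + q') * a + (p + p') * b ≡ (q * a + p * b) + (q' * a + p' * b)
    ∋ solve (a ∷ b ∷ p ∷ q ∷ p' ∷ q' ∷ [])

  val-carry : ∀ r t s → val (r + t * a , s) ≡ val (r , s + t * b)
  val-carry r t s =
    s * a + (r + t * a) * b ≡ (s + t * b) * a + r * b ∋ solve (a ∷ b ∷ r ∷ t ∷ s ∷ [])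

  ∣∧<⇒≡0 : ∀ {d} → a ∣ d → d < a → d ≡ 0
  ∣∧<⇒≡0 {zero} _ _ = refl
  ∣∧<⇒≡0 {suc d} a∣d d<a = ⊥-elim (>⇒∤ d<a a∣d)

  val-shift : ∀ p q q' d → val (p , q) ≡ val (p + d , q') → q * a ≡ q' * a + d * b
  val-shift p q q' d eq = +-cancelʳ-≡ (p * b) _ _ (trans eq
    (q' * a + (p + d) * b ≡ (q' * a + d * b) + p * b ∋ solve (a ∷ b ∷ p ∷ q' ∷ d ∷ [])))

  val-injective-≤ : ∀ {p q p' q'} → p ≤ p' → p' < a → val (p , q) ≡ val (p' , q') → (p , q) ≡ (p' , q')
  val-injective-≤ {p} {q} {p'} {q'} p≤p' p'<a eq with m≤n⇒∃[o]m+o≡n p≤p'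
  ... | d , refl with ∣∧<⇒≡0 a∣d (≤-<-trans (m≤n+m d p) p'<a)
    where
    a∣d : a ∣ d
    a∣d = coprime-divisor coprime (subst (a ∣_) (*-comm d b)
      (∣m+n∣m⇒∣n (subst (a ∣_) (val-shift p q q' d eq) (n∣m*n q)) (n∣m*n q')))
  ...   | refl = cong₂ _,_ (sym (+-identityʳ p))
                   (*-cancelʳ-≡ q q' a (trans (val-shift p q q' 0 eq) (+-identityʳ (q' * a))))

  val-injective : ∀ {P Q} → proj₁ P < a → proj₁ Q < a → val P ≡ val Q → P ≡ Q
  val-injective {p , q} {p' , q'} p<a p'<a eq with ≤-total p p'
  ... | inj₁ p≤p' = val-injective-≤ p≤p' p'<a eq
  ... | inj₂ p'≤p = sym (val-injective-≤ p'≤p p<a (sym eq))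

  val-reduce : ∀ P → Σ Point λ P' → proj₁ P' < a × val P ≡ val P'
  val-reduce (p , q) = (p % a , q + (p / a) * b) , m%n<n p a ,
    trans (cong (λ p → val (p , q)) (m≡m%n+[m/n]*n p a)) (val-carry (p % a) (p / a) q)

  -- A carry p + p' ≥ a would add b to the coefficient of a, which is j < b.
  val-split : ∀ {P} Q R → proj₁ P < a → proj₂ P < b → proj₁ Q < a → proj₁ R < a →
              val Q + val R ≡ val P → Q ⊕ R ≡ P
  val-split {i , j} (p , q) (p' , q') i<a j<b p<a p'<a eq with p + p' <? a
  ... | yes p+p'<a = val-injective p+p'<a i<a (trans (val-⊕ (p , q) (p' , q')) eq)
  ... | no p+p'≮a with m≤n⇒∃[o]m+o≡n (≮⇒≥ p+p'≮a)
  ...   | r , a+r≡p+p' = ⊥-elim (<-irrefl refl (<-≤-trans j<b (begin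
    b                ≤⟨ m≤n+m b (q + q') ⟩
    q + q' + b       ≡⟨ cong (q + q' +_) (*-identityˡ b) ⟨
    q + q' + 1 * b   ≡⟨ ,-injectiveʳ (val-injective r<a i<a carried) ⟩
    j                ∎)))
    where
    open ≤-Reasoning
    r<a : r < a
    r<a = +-cancelˡ-< a r a (subst (_< a + a) (sym a+r≡p+p') (+-mono-< p<a p'<a))
    r+a≡p+p' : r + 1 * a ≡ p + p'
    r+a≡p+p' = trans (cong (r +_) (*-identityˡ a)) (trans (+-comm r a) a+r≡p+p')
    carried : val (r , q + q' + 1 * b) ≡ val (i , j)
    carried = begin-equality
      val (r , q + q' + 1 * b)  ≡⟨ val-carry r 1 (q + q') ⟨
      val (r + 1 * a , q + q')  ≡⟨ cong (λ s → val (s , q + q')) r+a≡p+p' ⟩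
      val ((p , q) ⊕ (p' , q')) ≡⟨ val-⊕ (p , q) (p' , q') ⟩
      val (p , q) + val (p' , q') ≡⟨ eq ⟩
      val (i , j)             ∎

  ∈U⇒combination : ∀ x → x ∈U[ a , b ] → Σ Point λ P → x ≡ val P
  ∈U⇒combination = <-rec _ combination
    where
    combination : ∀ x → (∀ {y} → y < x → y ∈U[ a , b ] → Σ Point λ P → y ≡ val P) →
                  x ∈U[ a , b ] → Σ Point λ P → x ≡ val P
    combination x rec x∈U with ∈U-cases {x} x∈U
    ... | inj₁ refl = (0 , 1) , sym val-0,1
    ... | inj₂ (inj₁ refl) = (1 , 0) , sym val-1,0
    ... | inj₂ (inj₂ (y , y∈U , z , z∈U , y<z , y+z≡x)) with summands-< y∈U y<z y+z≡x
    ...   | y<x , z<x with rec y<x y∈U | rec z<x z∈U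
    ...     | P , refl | Q , refl = P ⊕ Q , trans (sym y+z≡x) (sym (val-⊕ P Q))

  ∈U⇒val : ∀ {x} → x ∈U[ a , b ] → Σ Point λ P → proj₁ P < a × x ≡ val P
  ∈U⇒val {x} x∈U with ∈U⇒combination x x∈U
  ... | P , refl = val-reduce P

-- The characterisation

module Characterisation (a b : ℕ) (1<a : 1 < a) (a<b : a < b) (coprime : Coprime a b) where
  0<a : 0 < a
  0<a = <-trans z<s 1<a

  0<b : 0 < b
  0<b = <-trans 0<a a<b

  open Recurrence a b 0<a 0<b
  open Lattice a b 0<a 0<b coprime

  InBox : Point → Set
  InBox (i , j) = i < a × j < b

  summand-in-box : ∀ {P} Q R → Q ⊕ R ≡ P → InBox P → InBox Q
  summand-in-box (p , q) R refl (p+p'<a , q+q'<b) =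
    ≤-<-trans (m≤m+n p _) p+p'<a , ≤-<-trans (m≤m+n q _) q+q'<b

  Characterised : Point → Set
  Characterised P = InBox P → (val P ∈U[ a , b ] ⇔ Special P)

  module Step (P : Point) (box : InBox P) (ih : ∀ {Q} → size Q < size P → Characterised Q) where

    summand-characterised : ∀ Q R → Q ⊕ R ≡ P → R ≢ (0 , 0) → val Q ∈U[ a , b ] ⇔ Special Q
    summand-characterised Q R Q⊕R≡P R≢0 = ih (summand-size-< Q⊕R≡P R≢0) (summand-in-box Q R Q⊕R≡P box)

    summand-<a : ∀ Q R → Q ⊕ R ≡ P → proj₁ Q < a
    summand-<a Q R Q⊕R≡P = proj₁ (summand-in-box Q R Q⊕R≡P box)

    rep⇒split : ∀ {x} → IsRep (val P) x →
                Σ Point λ Q → Σ Point λ R → SpecialSplit P Q R × val Q < val R × x ≡ val Q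
    rep⇒split {x} (x∈U , y , y∈U , x<y , x+y≡n) with ∈U⇒val {x} x∈U | ∈U⇒val {y} y∈U
    ... | Q , Q<a , refl | R , R<a , refl =
      Q , R , (Q⊕R≡P , Equivalence.to (summand-characterised Q R Q⊕R≡P R≢0) x∈U
                     , Equivalence.to (summand-characterised R Q (trans (⊕-comm R Q) Q⊕R≡P) Q≢0) y∈U)
      , x<y , refl
      where
      Q⊕R≡P : Q ⊕ R ≡ P
      Q⊕R≡P = val-split Q R (proj₁ box) (proj₂ box) Q<a R<a x+y≡n
      Q≢0 : Q ≢ (0 , 0)
      Q≢0 refl = 0∉U 0<a 0<b x∈U
      R≢0 : R ≢ (0 , 0)
      R≢0 refl = <-irrefl refl (≤-<-trans z≤n x<y)

    split⇒rep : ∀ {Q R} → SpecialSplit P Q R → val Q < val R → IsRep (val P) (val Q)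
    split⇒rep {Q} {R} (Q⊕R≡P , special-Q , special-R) Q<R =
      Equivalence.from (summand-characterised Q R Q⊕R≡P (special⇒≢0 special-R)) special-Q ,
      val R ,
      Equivalence.from (summand-characterised R Q (trans (⊕-comm R Q) Q⊕R≡P) (special⇒≢0 special-Q))
        special-R ,
      Q<R , trans (sym (val-⊕ Q R)) (cong val Q⊕R≡P)

    chosen-<a : ∀ {Q R A} → SpecialSplit P Q R → A ∈⟨ Q , R ⟩ → proj₁ A < a
    chosen-<a {Q} {R} (Q⊕R≡P , _) (inj₁ refl) = summand-<a Q R Q⊕R≡P
    chosen-<a {Q} {R} (Q⊕R≡P , _) (inj₂ refl) = summand-<a R Q (trans (⊕-comm R Q) Q⊕R≡P)

    split-val-≢ : ∀ {Q R} → SpecialSplit P Q R → Q ≢ R → val Q ≢ val R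
    split-val-≢ s Q≢R = Q≢R ∘ val-injective (chosen-<a s (inj₁ refl)) (chosen-<a s (inj₂ refl))

    split⇒rep-of-smaller : ∀ {Q R} → SpecialSplit P Q R → Q ≢ R →
                           Σ Point λ A → A ∈⟨ Q , R ⟩ × IsRep (val P) (val A)
    split⇒rep-of-smaller {Q} {R} s Q≢R with <-cmp (val Q) (val R)
    ... | tri< Q<R _ _ = Q , inj₁ refl , split⇒rep s Q<R
    ... | tri> _ _ R<Q = R , inj₂ refl , split⇒rep (split-comm s) R<Q
    ... | tri≈ _ Q≡R _ = ⊥-elim (split-val-≢ s Q≢R Q≡R)

    ordered-unique-split : UniqueSplit P →
                           Σ (UniqueSplit P) λ u → val (UniqueSplit.Q u) < val (UniqueSplit.R u)
    ordered-unique-split u@(uniqueSplit {Q} {R} s Q≢R _) with <-cmp (val Q) (val R)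
    ... | tri< Q<R _ _ = u , Q<R
    ... | tri> _ _ R<Q = uniqueSplit-swap u , R<Q
    ... | tri≈ _ Q≡R _ = ⊥-elim (split-val-≢ s Q≢R Q≡R)

    ordered-unique-split⇒unique-rep : (u : UniqueSplit P) → val (UniqueSplit.Q u) < val (UniqueSplit.R u) →
                                      ∀ {x} → IsRep (val P) x → x ≡ val (UniqueSplit.Q u)
    ordered-unique-split⇒unique-rep (uniqueSplit {Q} {R} s _ unique) Q<R rep with rep⇒split rep
    ... | Q' , R' , s' , Q'<R' , refl with unique s'
    ...   | inj₁ refl = refl
    ...   | inj₂ refl = ⊥-elim (<-asym Q<R (subst (λ S → val R < val S) (split-complement s s' refl) Q'<R'))

    unique-split⇒∈U : UniqueSplit P → b < val P → val P ∈U[ a , b ]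
    unique-split⇒∈U u b<n with ordered-unique-split u
    ... | u , Q<R =
      unique-rep⇒∈U b<n (split⇒rep (UniqueSplit.split u) Q<R) (ordered-unique-split⇒unique-rep u Q<R)

    two-splits⇒∉U : TwoSplits P → val P ≢ a → val P ≢ b → ¬ val P ∈U[ a , b ]
    two-splits⇒∉U t@(twoSplits s s' Q≢R Q'≢R' _ _) n≢a n≢b
      with split⇒rep-of-smaller s Q≢R | split⇒rep-of-smaller s' Q'≢R'
    ... | A , A∈QR , rep | B , B∈Q'R' , rep' = two-reps⇒∉U n≢a n≢b rep rep' λ A≡B →
      two-splits-disjoint t A∈QR
        (subst (_∈⟨ _ , _ ⟩) (sym (val-injective (chosen-<a s A∈QR) (chosen-<a s' B∈Q'R') A≡B)) B∈Q'R')

    trivial-splits⇒∉U : (∀ {Q R} → SpecialSplit P Q R → Q ≡ R) →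
                        val P ≢ a → val P ≢ b → ¬ val P ∈U[ a , b ]
    trivial-splits⇒∉U trivial n≢a n≢b = no-rep⇒∉U n≢a n≢b λ rep →
      let _ , _ , s , Q<R , _ = rep⇒split rep in <-irrefl (cong val (trivial s)) Q<R

  val≢a : ∀ {P} → InBox P → P ≢ (0 , 1) → val P ≢ a
  val≢a box P≢0,1 eq = P≢0,1 (val-injective (proj₁ box) 0<a (trans eq (sym val-0,1)))

  val≢b : ∀ {P} → InBox P → P ≢ (1 , 0) → val P ≢ b
  val≢b box P≢1,0 eq = P≢1,0 (val-injective (proj₁ box) 1<a (trans eq (sym val-1,0)))

  b<val : ∀ i j → b < val (suc i , suc j)
  b<val i j = begin-strict
    b                          ≤⟨ m≤m+n b (i * b) ⟩
    b + i * b                  <⟨ m<n+m (b + i * b) (≤-trans 0<a (m≤m+n a (j * a))) ⟩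
    (a + j * a) + (b + i * b)  ∎
    where open ≤-Reasoning

  step : ∀ P → (∀ {Q} → size Q < size P → Characterised Q) → Characterised P
  step (0 , 0) _ _ = mk⇔ (⊥-elim ∘ 0∉U 0<a 0<b) (λ special → ⊥-elim (special⇒≢0 special refl))
  step (0 , 1) _ _ = mk⇔ (λ _ → inj₁ refl) (λ _ → subst (_∈U[ a , b ]) (sym val-0,1) a∈U)
  step (1 , 0) _ _ = mk⇔ (λ _ → inj₂ (inj₁ refl)) (λ _ → subst (_∈U[ a , b ]) (sym val-1,0) b∈U)
  step (0 , suc (suc j)) ih box = mk⇔
    (⊥-elim ∘ Step.trivial-splits⇒∉U _ box ih split-0, (val≢a box λ ()) (val≢b box λ ()))
    (λ special → case special-0, special of λ ())
  step (suc (suc i) , 0) ih box = mk⇔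
    (⊥-elim ∘ Step.trivial-splits⇒∉U _ box ih split-,0 (val≢a box λ ()) (val≢b box λ ()))
    (λ special → case special-,0 special of λ ())
  step (suc i , suc j) ih box with special? (suc i , suc j)
  ... | yes special = mk⇔ (λ _ → special)
    (λ _ → Step.unique-split⇒∈U _ box ih (special-split-unique i j special) (b<val i j))
  ... | no nonspecial = mk⇔
    (⊥-elim ∘ Step.two-splits⇒∉U _ box ih (nonspecial-two-splits i j nonspecial)
                                  (val≢a box λ ()) (val≢b box λ ()))
    (⊥-elim ∘ nonspecial)

  characterised : ∀ P → Characterised P
  characterised = All.wfRec (On.wellFounded size <-wellFounded) 0ℓ Characterised step

lemma5p7 : (a b : ℕ) → 0 < a → a < b → Coprime a b →
           (i j : ℕ) → 0 < i → i < a → 0 < j → j < b →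
           ((j * a + i * b) ∈U[ a , b ] ⇔ (j ≡ 1 ⊎ i ≡ 1 ⊎ (Odd i × Odd j)))
lemma5p7 a b _ a<b coprime i j 0<i i<a _ j<b =
  Characterisation.characterised a b (≤-<-trans 0<i i<a) a<b coprime (i , j) (i<a , j<b)
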